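{- In a $2$-connected distance critical graph, every vertex is contained in a cycle of length at least $5$.
   Context: All graphs are finite, simple and undirected. A connected graph $G$ is $2$-connected if $|V(G)|>2$ and removing any single vertex does not disconnect it. For vertices $x,y$ of a graph $G$, $d_G(x,y)$ is the length of a shortest path from $x$ to $y$ in $G$ ($\infty$ if none exists). A graph $G$ is distance critical if for every vertex $v \in V(G)$ there exist vertices $x,y \in V(G)\setminus\{v\}$ with $d_G(x,y) \neq d_{G-v}(x,y)$. -}

module Defs where

open import Data.Nat using (ℕ; suc; _≤_; _<_)
open import Data.Fin using (Fin)
open import Data.List using (List; []; _∷_; length; head; last)
open import Data.List.Relation.Unary.All using (All)
open import Data.List.Relation.Unary.Linked using (Linked)
open import Data.List.Relation.Unary.Unique.Propositional using (Unique)
open import Data.List.Membership.Propositional using (_∈_)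
open import Data.Maybe using (Maybe; just; nothing)
open import Data.Product using (Σ; _×_; ∃; ∃-syntax)
open import Relation.Nullary using (¬_)
open import Relation.Binary.PropositionalEquality using (_≡_; _≢_)
open import Data.Unit using (⊤)

record Graph (n : ℕ) : Set₁ where
  field
    Adj    : Fin n → Fin n → Set
    sym    : ∀ {x y} → Adj x y → Adj y x
    irrefl : ∀ {x} → ¬ Adj x x
open Graph public

-- P restricts to an induced subgraph (P = λ _ → ⊤ gives G itself,
-- P = (_≢ v) gives G - v).
record PathIn {n : ℕ} (G : Graph n) (P : Fin n → Set) (x y : Fin n) (k : ℕ) : Set where
  field
    verts    : List (Fin n)
    inside   : All P verts
    adjacent : Linked (Adj G) verts
    distinct : Unique verts
    len      : length verts ≡ suc k     -- the path has k edges
    start    : head verts ≡ just x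
    end      : last verts ≡ just y

-- Distance in the subgraph induced by P: nothing stands for ∞.
IsDistIn : {n : ℕ} → Graph n → (Fin n → Set) → Fin n → Fin n → Maybe ℕ → Set
IsDistIn G P x y (just k) = PathIn G P x y k × (∀ j → j < k → ¬ PathIn G P x y j)
IsDistIn G P x y nothing  = ∀ j → ¬ PathIn G P x y j

Everywhere : {n : ℕ} → Fin n → Set
Everywhere _ = ⊤

IsDist : {n : ℕ} → Graph n → Fin n → Fin n → Maybe ℕ → Set
IsDist G = IsDistIn G Everywhere

IsDistMinus : {n : ℕ} → Graph n → Fin n → Fin n → Fin n → Maybe ℕ → Set
IsDistMinus G v = IsDistIn G (λ w → w ≢ v)

Connected : {n : ℕ} → Graph n → Set
Connected G = ∀ x y → ∃[ k ] PathIn G Everywhere x y k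

TwoConnected : {n : ℕ} → Graph n → Set
TwoConnected {n} G =
  2 < n × Connected G ×
  (∀ v x y → x ≢ v → y ≢ v → ∃[ k ] PathIn G (λ w → w ≢ v) x y k)

DistanceCritical : {n : ℕ} → Graph n → Set
DistanceCritical G =
  ∀ v → ∃[ x ] ∃[ y ] (x ≢ v × y ≢ v ×
        ∃[ d₁ ] ∃[ d₂ ] (IsDist G x y d₁ × IsDistMinus G v x y d₂ × d₁ ≢ d₂))

record Cycle {n : ℕ} (G : Graph n) (k : ℕ) : Set where
  field
    verts    : List (Fin n)
    len      : length verts ≡ k
    atLeast3 : 3 ≤ k
    adjacent : Linked (Adj G) verts
    distinct : Unique verts
    first    : Fin n
    final    : Fin n
    isFirst  : head verts ≡ just first
    isLast   : last verts ≡ just final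
    closing  : Adj G final first

OnCycleAtLeast5 : {n : ℕ} → Graph n → Fin n → Set
OnCycleAtLeast5 G v = ∃[ k ] Σ (Cycle G k) λ C → 5 ≤ k × v ∈ Cycle.verts C

{-# OPTIONS --safe #-}
-- If deleting v changes d(x, y) it can only increase it, so a shortest x–y
-- walk W in G must visit v. Let a be the vertex before the first visit and b
-- the vertex after the last one. Shortness of W in G forces a ≠ b and a ≁ b,
-- and since G - v has no x–y walk as short as W, a and b have no common
-- neighbour other than v. So every a–b path in the connected graph G - v has
-- length at least 3, and closing it through v gives a cycle of length at
-- least 5.
module Submission where

open import Defs
open import Data.Nat using (ℕ; zero; suc; pred; _+_; _≤_; _<_; z≤n; s≤s)
open import Data.Nat.Properties
  using (≤-refl; ≤-trans; <-≤-trans; ≤-<-trans; m≤n⇒m≤1+n; m<n⇒m<1+n; n<1+n; +-monoʳ-<;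
         <⇒≱; ≮⇒≥; ≤∧≢⇒<; n≮n)
open import Data.Fin using (Fin; _≟_)
open import Data.List using (List; []; _∷_; length; head; last)
open import Data.List.Relation.Unary.All as All using (All; []; _∷_)
open import Data.List.Relation.Unary.All.Properties using (¬Any⇒All¬)
open import Data.List.Relation.Unary.Any using (here; there)
open import Data.List.Relation.Unary.Linked using (Linked; [-]; _∷_)
open import Data.List.Relation.Unary.Unique.Propositional using (Unique)
open import Data.List.Relation.Unary.AllPairs using ([]; _∷_)
open import Data.List.Membership.Propositional using (_∈_)
open import Data.Maybe using (Maybe; just; nothing)
open import Data.Product using (Σ; _×_; _,_; ∃-syntax; proj₂)
open import Data.Sum using (_⊎_; inj₁; inj₂)
open import Data.Empty using (⊥; ⊥-elim)
open import Data.Unit using (tt)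
open import Function using (_∘_)
open import Relation.Nullary using (¬_; yes; no)
open import Relation.Binary.PropositionalEquality using (_≡_; _≢_; refl; cong; ≢-sym)

module _ {n : ℕ} (G : Graph n) where

  open import Data.List.Membership.DecPropositional (_≟_ {n}) using (_∈?_)

  data Walk (P : Fin n → Set) : Fin n → Fin n → ℕ → Set where
    [_]  : ∀ {x} → P x → Walk P x x 0
    cons : ∀ {x y z k} → P x → Adj G x y → Walk P y z k → Walk P x z (suc k)

  vertices : ∀ {P x y k} → Walk P x y k → List (Fin n)
  vertices ([_] {x} _)     = x ∷ []
  vertices (cons {x} _ _ w) = x ∷ vertices w

  start-satisfies : ∀ {P x y k} → Walk P x y k → P x
  start-satisfies [ p ]        = p
  start-satisfies (cons p _ _) = p

  end-satisfies : ∀ {P x y k} → Walk P x y k → P y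
  end-satisfies [ p ]        = p
  end-satisfies (cons _ _ w) = end-satisfies w

  _++_ : ∀ {P x y z i j} → Walk P x y i → Walk P y z j → Walk P x z (i + j)
  [ _ ]      ++ w′ = w′
  cons p a w ++ w′ = cons p a (w ++ w′)

  map : ∀ {P Q : Fin n → Set} {x y k} → (∀ {u} → P u → Q u) → Walk P x y k → Walk Q x y k
  map f [ p ]        = [ f p ]
  map f (cons p a w) = cons (f p) a (map f w)

  weaken : ∀ {P x y k} → Walk P x y k → Walk Everywhere x y k
  weaken = map (λ _ → tt)

  fromPath : ∀ {P x y k} → PathIn G P x y k → Walk P x y k
  fromPath p = fromList (PathIn.verts p) (PathIn.inside p) (PathIn.adjacent p)
                        (PathIn.len p) (PathIn.start p) (PathIn.end p)
    where
    fromList : ∀ {P x y k} (xs : List (Fin n)) → All P xs → Linked (Adj G) xs →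
               length xs ≡ suc k → head xs ≡ just x → last xs ≡ just y → Walk P x y k
    fromList {k = zero}  (_ ∷ [])     (p ∷ []) _       _  refl refl = [ p ]
    fromList {k = suc k} (_ ∷ y ∷ xs) (p ∷ ps) (a ∷ as) eq refl end =
      cons p a (fromList (y ∷ xs) ps as (cong pred eq) refl end)

  All-vertices : ∀ {P x y k} (w : Walk P x y k) → All P (vertices w)
  All-vertices [ p ]        = p ∷ []
  All-vertices (cons p _ w) = p ∷ All-vertices w

  Linked-vertices : ∀ {P x y k} (w : Walk P x y k) → Linked (Adj G) (vertices w)
  Linked-vertices [ _ ]                   = [-]
  Linked-vertices (cons _ a [ p ])        = a ∷ [-]
  Linked-vertices (cons _ a (cons p b w)) = a ∷ Linked-vertices (cons p b w)

  length-vertices : ∀ {P x y k} (w : Walk P x y k) → length (vertices w) ≡ suc k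
  length-vertices [ _ ]        = refl
  length-vertices (cons _ _ w) = cong suc (length-vertices w)

  head-vertices : ∀ {P x y k} (w : Walk P x y k) → head (vertices w) ≡ just x
  head-vertices [ _ ]        = refl
  head-vertices (cons _ _ _) = refl

  last-vertices : ∀ {P x y k} (w : Walk P x y k) → last (vertices w) ≡ just y
  last-vertices [ _ ]                   = refl
  last-vertices (cons _ _ [ _ ])        = refl
  last-vertices (cons _ _ (cons p b w)) = last-vertices (cons p b w)

  toPath : ∀ {P x y k} (w : Walk P x y k) → Unique (vertices w) → PathIn G P x y k
  toPath w u = record
    { verts = vertices w ; inside = All-vertices w ; adjacent = Linked-vertices w ; distinct = u
    ; len = length-vertices w ; start = head-vertices w ; end = last-vertices w }

  UniqueWalk : (Fin n → Set) → Fin n → Fin n → ℕ → Set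
  UniqueWalk P x y k = Σ (Walk P x y k) (Unique ∘ vertices)

  suffixFrom : ∀ {P x y z k} (w : Walk P y z k) → Unique (vertices w) → x ∈ vertices w →
               ∃[ j ] j ≤ k × UniqueWalk P x z j
  suffixFrom w@([ _ ])       u       (here refl) = _ , ≤-refl , w , u
  suffixFrom w@(cons _ _ _)  u       (here refl) = _ , ≤-refl , w , u
  suffixFrom   (cons _ _ w)  (_ ∷ u) (there x∈w) with suffixFrom w u x∈w
  ... | j , j≤k , w′ = j , m≤n⇒m≤1+n j≤k , w′

  -- A walk shortens to a path by cutting out the closed subwalk at each repeated vertex.
  shorten : ∀ {P x y k} → Walk P x y k → ∃[ j ] j ≤ k × UniqueWalk P x y j
  shorten [ p ] = 0 , z≤n , [ p ] , [] ∷ []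
  shorten {x = x} (cons p a w) with shorten w
  ... | j , j≤k , w′ , u with x ∈? vertices w′
  ...   | yes x∈w′ with suffixFrom w′ u x∈w′
  ...     | i , i≤j , w″ = i , m≤n⇒m≤1+n (≤-trans i≤j j≤k) , w″
  shorten (cons p a w) | j , j≤k , w′ , u | no x∉w′ =
    suc j , s≤s j≤k , cons p a w′ , ¬Any⇒All¬ (vertices w′) x∉w′ ∷ u

  WalksAtLeast : (Fin n → Set) → Fin n → Fin n → ℕ → Set
  WalksAtLeast P x y k = ∀ {m} → Walk P x y m → k ≤ m

  noShorterPath⇒walksAtLeast : ∀ {P x y k} → (∀ j → j < k → ¬ PathIn G P x y j) →
                               WalksAtLeast P x y k
  noShorterPath⇒walksAtLeast noPath w with shorten w
  ... | j , j≤m , w′ , u = ≮⇒≥ λ m<k → noPath j (≤-<-trans j≤m m<k) (toPath w′ u)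

  record Exit (v t : Fin n) (r : ℕ) : Set where
    constructor exit
    field
      {b}     : Fin n
      {j}     : ℕ
      vb      : Adj G v b
      suffix  : Walk (_≢ v) b t j
      shorter : j < r

  avoids-or-exits : ∀ {v s t r} → Walk Everywhere s t r → t ≢ v → Walk (_≢ v) s t r ⊎ Exit v t r
  avoids-or-exits [ _ ] t≢v = inj₁ [ t≢v ]
  avoids-or-exits {v} {s} (cons _ a w) t≢v with avoids-or-exits w t≢v
  ... | inj₂ (exit vb suf j<r) = inj₂ (exit vb suf (m<n⇒m<1+n j<r))
  ... | inj₁ w′ with s ≟ v
  ...   | yes refl = inj₂ (exit a w′ (n<1+n _))
  ...   | no s≢v   = inj₁ (cons s≢v a w′)

  -- The part of the walk between the first and the last visit of v is dropped,
  -- hence only an inequality for the length.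
  record Detour (v s t : Fin n) (k : ℕ) : Set where
    constructor detour
    field
      {a b}   : Fin n
      {i j}   : ℕ
      prefix  : Walk (_≢ v) s a i
      av      : Adj G a v
      vb      : Adj G v b
      suffix  : Walk (_≢ v) b t j
      shorter : i + suc (suc j) ≤ k

  avoids-or-detours : ∀ {v s t k} → Walk Everywhere s t k → s ≢ v → t ≢ v →
                      Walk (_≢ v) s t k ⊎ Detour v s t k
  avoids-or-detours [ _ ] s≢v _ = inj₁ [ s≢v ]
  avoids-or-detours {v} (cons {y = y} _ a w) s≢v t≢v with y ≟ v
  ... | yes refl with avoids-or-exits w t≢v
  ...   | inj₁ w′                = ⊥-elim (start-satisfies w′ refl)
  ...   | inj₂ (exit vb suf j<r) = inj₂ (detour [ s≢v ] a vb suf (s≤s j<r))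
  avoids-or-detours (cons _ a w) s≢v t≢v | no y≢v with avoids-or-detours w y≢v t≢v
  ... | inj₁ w′                           = inj₁ (cons s≢v a w′)
  ... | inj₂ (detour pre av vb suf short) = inj₂ (detour (cons s≢v a pre) av vb suf (s≤s short))

  length≥3 : ∀ {P a b k} → Walk P a b k → a ≢ b → ¬ Adj G a b →
             (∀ {z} → P z → Adj G a z → Adj G z b → ⊥) → 3 ≤ k
  length≥3 [ _ ]                              a≢b _   _        = ⊥-elim (a≢b refl)
  length≥3 (cons _ ab [ _ ])                  _   a≁b _        = ⊥-elim (a≁b ab)
  length≥3 (cons _ az (cons pz zb [ _ ]))     _   _   noCommon = ⊥-elim (noCommon pz az zb)
  length≥3 (cons _ _ (cons _ _ (cons _ _ _))) _   _   _        = s≤s (s≤s (s≤s z≤n))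

  closeCycle : ∀ {v a b k} → Adj G v a → PathIn G (_≢ v) a b k → Adj G b v → 1 ≤ k →
               Σ (Cycle G (suc (suc k))) λ C → v ∈ Cycle.verts C
  closeCycle {v} va record { verts = a ∷ as ; inside = outside ; adjacent = adj ; distinct = dist
                           ; len = len ; start = refl ; end = end } bv 1≤k =
    record { verts = v ∷ a ∷ as ; len = cong suc len ; atLeast3 = s≤s (s≤s 1≤k)
           ; adjacent = va ∷ adj ; distinct = All.map ≢-sym outside ∷ dist
           ; first = v ; final = _ ; isFirst = refl ; isLast = end ; closing = bv }
    , here refl

  ConnectedAvoiding : Fin n → Set
  ConnectedAvoiding v = ∀ x y → x ≢ v → y ≢ v → ∃[ k ] PathIn G (_≢ v) x y k

  distance-increases : ∀ {v x y : Fin n} {j : ℕ} {d₁ d₂ : Maybe ℕ} →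
    PathIn G (_≢ v) x y j → IsDist G x y d₁ → IsDistMinus G v x y d₂ → d₁ ≢ d₂ →
    ∃[ k ] Walk Everywhere x y k × WalksAtLeast Everywhere x y k × WalksAtLeast (_≢ v) x y (suc k)
  distance-increases {d₂ = nothing} Q _ noPath _ = ⊥-elim (noPath _ Q)
  distance-increases {d₁ = nothing} {just _} _ noPath (P₂ , _) _
    with shorten (weaken (fromPath P₂))
  ... | j , _ , w , u = ⊥-elim (noPath j (toPath w u))
  distance-increases {d₁ = just k₁} {just k₂} _ (P₁ , min₁) (P₂ , min₂) k₁≢k₂ =
    k₁ , fromPath P₁ , atLeast₁ , λ w → <-≤-trans k₁<k₂ (noShorterPath⇒walksAtLeast min₂ w)
    where
    atLeast₁ : WalksAtLeast Everywhere _ _ k₁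
    atLeast₁ = noShorterPath⇒walksAtLeast min₁
    k₁<k₂ : k₁ < k₂
    k₁<k₂ = ≤∧≢⇒< (atLeast₁ (weaken (fromPath P₂))) (k₁≢k₂ ∘ cong just)

  longCycleThrough : ∀ {v x y : Fin n} {k : ℕ} → ConnectedAvoiding v →
    x ≢ v → y ≢ v → Walk Everywhere x y k →
    WalksAtLeast Everywhere x y k → WalksAtLeast (_≢ v) x y (suc k) → OnCycleAtLeast5 G v
  longCycleThrough {v} {k = k} connected x≢v y≢v W minimal minimal-v
    with avoids-or-detours W x≢v y≢v
  ... | inj₁ W-v = ⊥-elim (n≮n k (minimal-v W-v))
  ... | inj₂ (detour {a} {b} {i} {j} pre av vb suf short)
    with connected a b (end-satisfies pre) (start-satisfies suf)
  ... | m , Q =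
    let C , v∈C = closeCycle (Graph.sym G av) Q (Graph.sym G vb) (≤-trans (s≤s z≤n) m≥3)
    in suc (suc m) , C , s≤s (s≤s m≥3) , v∈C
    where
    tooShort : ∀ {l} → Walk Everywhere _ _ l → l < k → ⊥
    tooShort w l<k = <⇒≱ l<k (minimal w)

    a≢b : a ≢ b
    a≢b refl = tooShort (weaken (pre ++ suf))
      (<-≤-trans (+-monoʳ-< i (m<n⇒m<1+n (n<1+n j))) short)

    a≁b : ¬ Adj G a b
    a≁b ab = tooShort (weaken pre ++ cons tt ab (weaken suf))
      (<-≤-trans (+-monoʳ-< i (n<1+n (suc j))) short)

    noCommon : ∀ {z} → z ≢ v → Adj G a z → Adj G z b → ⊥
    noCommon z≢v az zb =
      n≮n k (≤-trans (minimal-v (pre ++ cons (end-satisfies pre) az (cons z≢v zb suf))) short)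

    m≥3 : 3 ≤ m
    m≥3 = length≥3 (fromPath Q) a≢b a≁b noCommon

lemma3p2 : {n : ℕ} (G : Graph n) → TwoConnected G → DistanceCritical G →
    (v : Fin n) → OnCycleAtLeast5 G v
lemma3p2 G (_ , _ , connected) critical v with critical v
... | x , y , x≢v , y≢v , _ , _ , D₁ , D₂ , d₁≢d₂
  with distance-increases G (proj₂ (connected v x y x≢v y≢v)) D₁ D₂ d₁≢d₂
... | _ , W , minimal , minimal-v = longCycleThrough G (connected v) x≢v y≢v W minimal minimal-v
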